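{- For $n\ge 0$ let $C_{2n+1}(132)$ be the set of centrosymmetric permutations of $[2n+1]$ avoiding the pattern $132$, let $r_{n,k}$ be the number of elements of $C_{2n+1}(132)$ with exactly $k$ descents, and let $$R(x,y)=\sum_{n\ge 0}\sum_{\sigma\in C_{2n+1}(132)}x^n y^{\mathrm{des}(\sigma)}=\sum_{n,k\ge0}r_{n,k}x^ny^k .$$ Then $$R(x,y)=\frac{1}{1-x(1+y^2)}.$$ Hence, for every $n\ge 1$, $r_{n,k}=\binom{n}{k/2}$ if $k$ is even and $r_{n,k}=0$ if $k$ is odd.
   Context: A permutation $\sigma$ of $[m]=\{1,\dots,m\}$ is centrosymmetric if $\sigma(i)+\sigma(m+1-i)=m+1$ for all $i$. A permutation $\sigma$ avoids the pattern $132$ if there are no indices $i<j<k$ with $\sigma(i)<\sigma(k)<\sigma(j)$. A descent of $\sigma$ is an index $i$ with $\sigma(i)>\sigma(i+1)$, and $\mathrm{des}(\sigma)$ is the number of descents. -}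

module Defs where

open import Data.Nat using (ℕ; zero; suc; _+_; _*_; _∸_; _≟_)
open import Data.Nat.Combinatorics using (_C_)
open import Data.Integer using (ℤ; +_; -_) renaming (_+_ to _+ℤ_; _*_ to _*ℤ_)
open import Data.Fin using (Fin; toℕ; opposite; inject₁; _<_)
open import Data.Fin.Properties using (all?; any?; _<?_) renaming (_≟_ to _≟ᶠ_)
open import Data.List using (List; []; _∷_; length; filter; concatMap; map; allFin; upTo; foldr)
open import Data.Product using (Σ; ∃; _×_; _,_)
open import Relation.Binary.PropositionalEquality using (_≡_)
open import Relation.Nullary using (Dec; ¬_; ¬?)
open import Relation.Nullary.Decidable using (_×-dec_; _→-dec_)

-- A function [m] → [m], represented 0-indexed as Fin m → Fin m.
Fun : ℕ → Set
Fun m = Fin m → Fin m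

-- σ is a permutation (a bijection of the finite set [m]; injective suffices
-- on a finite set, and this is the standard definition for endofunctions of [m]).
IsPerm : ∀ {m} → Fun m → Set
IsPerm {m} σ = ∀ i j → σ i ≡ σ j → i ≡ j

-- Centrosymmetric: σ(i) + σ(m+1-i) = m+1 (1-indexed); 0-indexed: opposite i = m-1-i
-- and the condition reads σ(i) + σ(m-1-i) = m-1.
Centrosymmetric : ∀ {m} → Fun m → Set
Centrosymmetric {m} σ = ∀ i → toℕ (σ i) + toℕ (σ (opposite i)) ≡ m ∸ 1

Contains132 : ∀ {m} → Fun m → Set
Contains132 {m} σ =
  ∃ λ (i : Fin m) → ∃ λ (j : Fin m) → ∃ λ (k : Fin m) →
    (i < j) × (j < k) × (σ i < σ k) × (σ k < σ j)

Avoids132 : ∀ {m} → Fun m → Set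
Avoids132 σ = ¬ Contains132 σ

descentPositions : ∀ {m} → Fun (suc m) → List (Fin m)
descentPositions {m} σ = filter (λ i → σ (Fin.suc i) <? σ (inject₁ i)) (allFin m)

des : ∀ {m} → Fun (suc m) → ℕ
des σ = length (descentPositions σ)

isPerm? : ∀ {m} (σ : Fun m) → Dec (IsPerm σ)
isPerm? σ = all? (λ i → all? (λ j → (σ i ≟ᶠ σ j) →-dec (i ≟ᶠ j)))

centro? : ∀ {m} (σ : Fun m) → Dec (Centrosymmetric σ)
centro? {m} σ = all? (λ i → (toℕ (σ i) + toℕ (σ (opposite i))) ≟ (m ∸ 1))

contains132? : ∀ {m} (σ : Fun m) → Dec (Contains132 σ)
contains132? σ = any? (λ i → any? (λ j → any? (λ k →
  (i <? j) ×-dec (j <? k) ×-dec (σ i <? σ k) ×-dec (σ k <? σ j))))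

allFuns : ∀ m k → List (Fin k → Fin m)
allFuns m zero = (λ ()) ∷ []
allFuns m (suc k) = concatMap (λ f → map (λ a → cons a f) (allFin m)) (allFuns m k)
  where
  cons : Fin m → (Fin k → Fin m) → Fin (suc k) → Fin m
  cons a f Fin.zero = a
  cons a f (Fin.suc i) = f i

InC132des : (n d : ℕ) → Fun (suc (2 * n)) → Set
InC132des n d σ = IsPerm σ × Centrosymmetric σ × Avoids132 σ × (des σ ≡ d)

inC132des? : (n d : ℕ) (σ : Fun (suc (2 * n))) → Dec (InC132des n d σ)
inC132des? n d σ = isPerm? σ ×-dec centro? σ ×-dec ¬? (contains132? σ) ×-dec (des σ ≟ d)

r : ℕ → ℕ → ℕ
r n k = length (filter (inC132des? n k) (allFuns (suc (2 * n)) (suc (2 * n))))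

-- Bivariate formal power series over ℤ, given by coefficients: F n k = [x^n y^k] F.
Series2 : Set
Series2 = ℕ → ℕ → ℤ

sumTo : ℕ → (ℕ → ℤ) → ℤ
sumTo n f = foldr _+ℤ_ (+ 0) (map f (upTo (suc n)))

_⋆_ : Series2 → Series2 → Series2
(F ⋆ G) n k = sumTo n (λ a → sumTo k (λ b → F a b *ℤ G (n ∸ a) (k ∸ b)))

Rser : Series2
Rser n k = + r n k

oneSer : Series2
oneSer zero zero = + 1
oneSer _ _ = + 0

denomSer : Series2
denomSer zero zero = + 1
denomSer (suc zero) zero = - (+ 1)
denomSer (suc zero) (suc (suc zero)) = - (+ 1)
denomSer _ _ = + 0

module Submission where

-- Reversal-complementation maps 132 to 213 and fixes centrosymmetric σ, so each
-- σ ∈ C_{2n+1}(132) also avoids 213; such σ is a decreasing sequence of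
-- increasing runs, hence the ranking π of the positions by "(descents at or
-- after the position, then the position)" of its descent set D.  Conversely
-- this π avoids 132, has descent set D, and is centrosymmetric when D is
-- symmetric under x ↦ 2n-1-x.  Symmetric D correspond to bit vectors of length
-- n (their first half) with twice as many descents as set bits, so r n k counts
-- bit vectors with popcount k/2: binomial coefficients, obeying the recurrence
-- r (n+1) k = r n k + r n (k-2) that gives R·(1 - x - xy²) = 1.
-- Sequences are functions ℕ → ℕ on [0, m).  The file develops counting on
-- [0, n), runs, ranking, the permutation of a descent set, sums and counting
-- through a bijection, symmetric descent sets, the bit-vector bijection, the
-- binomial recurrence and the series identity; theorem2 comes last.

open import Data.Nat
open import Data.Nat.Properties
open import Data.Nat.Combinatorics using (_C_; nCk+nC[k+1]≡[n+1]C[k+1])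
open import Data.Bool using (Bool; true; false; T; if_then_else_)
import Data.Bool.Properties as Boolᵖ
open import Data.Fin as Fin using (Fin; toℕ; fromℕ<; opposite; inject₁; punchOut)
open import Data.Fin.Properties as Finᵖ
  using (toℕ-fromℕ<; toℕ-injective; toℕ<n; opposite-prop; toℕ-inject₁; any?; all?;
         punchOut-injective; injective⇒≤)
open import Data.Vec as Vec using (Vec; lookup)
import Data.Vec.Properties as Vecᵖ
open import Data.List using (List; []; _∷_; length; filter; tabulate; map; _++_; concatMap; allFin)
open import Data.Product using (Σ; ∃; _×_; _,_; proj₁; proj₂)
open import Data.Sum using (_⊎_; inj₁; inj₂)
open import Data.Empty using (⊥; ⊥-elim)
open import Data.Unit using (tt)
open import Relation.Nullary using (¬_; Dec; yes; no; does)
open import Relation.Nullary.Decidable using (_×-dec_; dec-true; dec-false)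
open import Relation.Binary using (tri<; tri≈; tri>)
open import Relation.Binary.PropositionalEquality
open import Algebra.Properties.CommutativeSemigroup +-commutativeSemigroup
  using () renaming (interchange to +-interchange)
open import Defs

χ : Bool → ℕ
χ true = 1
χ false = 0

χ≤1 : ∀ b → χ b ≤ 1
χ≤1 true = ≤-refl
χ≤1 false = z≤n

χ-mono : ∀ a b → (a ≡ true → b ≡ true) → χ a ≤ χ b
χ-mono false b _ = z≤n
χ-mono true b a⇒b rewrite a⇒b refl = ≤-refl

count : ℕ → (ℕ → Bool) → ℕ
count zero f = 0
count (suc n) f = χ (f 0) + count n (λ i → f (suc i))

count-cong : ∀ n f g → (∀ i → i < n → f i ≡ g i) → count n f ≡ count n g
count-cong zero f g f≗g = refl
count-cong (suc n) f g f≗g = cong₂ _+_ (cong χ (f≗g 0 z<s))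
  (count-cong n _ _ (λ i i<n → f≗g (suc i) (s<s i<n)))

count-+ : ∀ a c f → count (a + c) f ≡ count a f + count c (λ i → f (a + i))
count-+ zero c f = refl
count-+ (suc a) c f = trans (cong (χ (f 0) +_) (count-+ a c (λ i → f (suc i))))
  (sym (+-assoc (χ (f 0)) _ _))

count-snoc : ∀ n f → count (suc n) f ≡ count n f + χ (f n)
count-snoc zero f = +-comm (χ (f 0)) 0
count-snoc (suc n) f = trans (cong (χ (f 0) +_) (count-snoc n (λ i → f (suc i))))
  (sym (+-assoc (χ (f 0)) _ _))

count-reverse : ∀ n f → count n f ≡ count n (λ i → f (n ∸ suc i))
count-reverse zero f = refl
count-reverse (suc n) f = trans (count-snoc n f)
  (trans (cong (_+ χ (f n)) (count-reverse n f)) (+-comm _ (χ (f n))))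

count-sum : ∀ n f g h → (∀ i → i < n → χ (f i) ≡ χ (g i) + χ (h i)) →
  count n f ≡ count n g + count n h
count-sum zero f g h e = refl
count-sum (suc n) f g h e = begin
  χ (f 0) + count n (λ i → f (suc i))
    ≡⟨ cong₂ _+_ (e 0 z<s) (count-sum n _ _ _ (λ i i<n → e (suc i) (s<s i<n))) ⟩
  (χ (g 0) + χ (h 0)) + (count n (λ i → g (suc i)) + count n (λ i → h (suc i)))
    ≡⟨ +-interchange (χ (g 0)) (χ (h 0)) _ _ ⟩
  (χ (g 0) + count n (λ i → g (suc i))) + (χ (h 0) + count n (λ i → h (suc i))) ∎
  where open ≡-Reasoning

count≤ : ∀ n f → count n f ≤ n
count≤ zero f = z≤n
count≤ (suc n) f = +-mono-≤ (χ≤1 (f 0)) (count≤ n _)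

count-mono : ∀ p q f → p ≤ q → count p f ≤ count q f
count-mono p q f p≤q with m≤n⇒∃[o]m+o≡n p≤q
... | o , refl = subst (count p f ≤_) (sym (count-+ p o f)) (m≤m+n _ _)

count≡0⇒ : ∀ n f → count n f ≡ 0 → ∀ i → i < n → f i ≡ false
count≡0⇒ (suc n) f e zero _ with f 0 | e
... | false | _ = refl
count≡0⇒ (suc n) f e (suc i) (s<s i<n) with f 0 | e
... | false | e′ = count≡0⇒ n (λ j → f (suc j)) e′ i i<n

⇒count≡0 : ∀ n f → (∀ i → i < n → f i ≡ false) → count n f ≡ 0
⇒count≡0 zero f f≡false = refl
⇒count≡0 (suc n) f f≡false rewrite f≡false 0 z<s =
  ⇒count≡0 n _ (λ i i<n → f≡false (suc i) (s<s i<n))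

count≡1 : ∀ n f i₀ → i₀ < n → f i₀ ≡ true → (∀ i → i < n → f i ≡ true → i ≡ i₀) →
  count n f ≡ 1
count≡1 (suc n) f zero _ f₀ unique rewrite f₀ = cong suc (⇒count≡0 n _ others)
  where
  others : ∀ i → i < n → f (suc i) ≡ false
  others i i<n with f (suc i) in fi
  ... | false = refl
  ... | true with () ← unique (suc i) (s<s i<n) fi
count≡1 (suc n) f (suc i₀) (s<s i₀<n) fi₀ unique with f 0 in f0
... | true with () ← unique 0 z<s f0
... | false = count≡1 n (λ i → f (suc i)) i₀ i₀<n fi₀
  (λ i i<n fi → suc-injective (unique (suc i) (s<s i<n) fi))

flat⇒vanishes : ∀ p q f → p ≤ q → count q f ≡ count p f →
  ∀ x → p ≤ x → x < q → f x ≡ false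
flat⇒vanishes p q f p≤q e x p≤x x<q with m≤n⇒∃[o]m+o≡n p≤q | m≤n⇒∃[o]m+o≡n p≤x
... | o , refl | o′ , refl =
  count≡0⇒ o (λ i → f (p + i))
    (+-cancelˡ-≡ (count p f) _ _ (trans (sym (count-+ p o f)) (trans e (sym (+-identityʳ _)))))
    o′ (+-cancelˡ-< p o′ o x<q)

vanishes⇒flat : ∀ p q f → p ≤ q → (∀ x → p ≤ x → x < q → f x ≡ false) →
  count q f ≡ count p f
vanishes⇒flat p q f p≤q f≡false with m≤n⇒∃[o]m+o≡n p≤q
... | o , refl = trans (count-+ p o f) (trans (cong (count p f +_)
  (⇒count≡0 o _ (λ i i<o → f≡false (p + i) (m≤m+n p i) (+-monoʳ-< p i<o)))) (+-identityʳ _))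

count<n : ∀ n f i → i < n → f i ≡ false → count n f < n
count<n (suc n) f zero _ fi rewrite fi = s≤s (count≤ n _)
count<n (suc n) f (suc i) (s<s i<n) fi =
  +-mono-≤-< (χ≤1 (f 0)) (count<n n (λ j → f (suc j)) i i<n fi)

count-⇒ : ∀ n f g → (∀ i → i < n → f i ≡ true → g i ≡ true) → count n f ≤ count n g
count-⇒ zero f g f⇒g = z≤n
count-⇒ (suc n) f g f⇒g = +-mono-≤ (χ-mono (f 0) (g 0) (f⇒g 0 z<s))
  (count-⇒ n _ _ (λ i i<n → f⇒g (suc i) (s<s i<n)))

count-⇒-strict : ∀ n f g → (∀ i → i < n → f i ≡ true → g i ≡ true) →
  ∀ j → j < n → f j ≡ false → g j ≡ true → count n f < count n g
count-⇒-strict (suc n) f g f⇒g zero _ fj gj rewrite fj | gj =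
  s≤s (count-⇒ n _ _ (λ i i<n → f⇒g (suc i) (s<s i<n)))
count-⇒-strict (suc n) f g f⇒g (suc j) (s<s j<n) fj gj =
  +-mono-≤-< (χ-mono (f 0) (g 0) (f⇒g 0 z<s))
    (count-⇒-strict n _ _ (λ i i<n → f⇒g (suc i) (s<s i<n)) j j<n fj gj)

<ᵇ-true : ∀ {a b} → a < b → (a <ᵇ b) ≡ true
<ᵇ-true {a} {b} a<b with a <ᵇ b | <⇒<ᵇ a<b
... | true | _ = refl

<ᵇ-true⁻ : ∀ {a b} → (a <ᵇ b) ≡ true → a < b
<ᵇ-true⁻ {a} {b} e = <ᵇ⇒< a b (subst T (sym e) tt)

<ᵇ-false : ∀ {a b} → ¬ a < b → (a <ᵇ b) ≡ false
<ᵇ-false {a} {b} a≮b with a <ᵇ b in e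
... | false = refl
... | true = ⊥-elim (a≮b (<ᵇ-true⁻ e))

<ᵇ-false⁻ : ∀ {a b} → (a <ᵇ b) ≡ false → ¬ a < b
<ᵇ-false⁻ e a<b with () ← trans (sym e) (<ᵇ-true a<b)

<ᵇ-cong : ∀ {a b c d} → (a < b → c < d) → (c < d → a < b) → (a <ᵇ b) ≡ (c <ᵇ d)
<ᵇ-cong {a} {b} {c} {d} to from with a <ᵇ b in e₁ | c <ᵇ d in e₂
... | true | true = refl
... | false | false = refl
... | true | false = ⊥-elim (<ᵇ-false⁻ e₂ (to (<ᵇ-true⁻ e₁)))
... | false | true = ⊥-elim (<ᵇ-false⁻ e₁ (from (<ᵇ-true⁻ e₂)))

≡ᵇ-true : ∀ {a b} → a ≡ b → (a ≡ᵇ b) ≡ true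
≡ᵇ-true {a} {b} a≡b with a ≡ᵇ b | ≡⇒≡ᵇ a b a≡b
... | true | _ = refl

≡ᵇ-true⁻ : ∀ {a b} → (a ≡ᵇ b) ≡ true → a ≡ b
≡ᵇ-true⁻ {a} {b} e = ≡ᵇ⇒≡ a b (subst T (sym e) tt)

≡ᵇ-false : ∀ {a b} → a ≢ b → (a ≡ᵇ b) ≡ false
≡ᵇ-false {a} {b} a≢b with a ≡ᵇ b in e
... | false = refl
... | true = ⊥-elim (a≢b (≡ᵇ-true⁻ e))

∸-<-reflect : ∀ N a b → N ∸ a < N ∸ b → b < a
∸-<-reflect N a b lt = ≰⇒> (λ a≤b → <⇒≱ lt (∸-monoʳ-≤ N a≤b))

descent : (ℕ → ℕ) → ℕ → Bool
descent v x = v (suc x) <ᵇ v x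

ascents⇒< : ∀ (v : ℕ → ℕ) p q → (∀ x → p ≤ x → x < q → v x < v (suc x)) → p < q → v p < v q
ascents⇒< v p (suc q) ascent p<sq with m≤n⇒m<n∨m≡n (≤-pred p<sq)
... | inj₁ p<q = <-trans (ascents⇒< v p q (λ x p≤x x<q → ascent x p≤x (m<n⇒m<1+n x<q)) p<q)
                         (ascent q (<⇒≤ p<q) ≤-refl)
... | inj₂ refl = ascent p ≤-refl ≤-refl

-- For an injective sequence v on [0, m) avoiding 132 and 213, v p < v q with
-- p < q holds exactly when v has no descent in [p, q), i.e. when p and q lie in
-- the same increasing run.
module Runs (m : ℕ) (v : ℕ → ℕ)
  (inj : ∀ x y → x < m → y < m → v x ≡ v y → x ≡ y)
  (avoid132 : ∀ i j k → i < j → j < k → k < m → v i < v k → v k < v j → ⊥)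
  (avoid213 : ∀ i j k → i < j → j < k → k < m → v j < v i → v i < v k → ⊥) where

  sandwiched : ∀ p x q → p < x → x < q → q < m → v p < v q → v p < v x × v x < v q
  sandwiched p x q p<x x<q q<m vp<vq = above , below
    where
    x<m : x < m
    x<m = <-trans x<q q<m
    p<m : p < m
    p<m = <-trans p<x x<m
    below : v x < v q
    below with <-cmp (v x) (v q)
    ... | tri< lt _ _ = lt
    ... | tri≈ _ e _ = ⊥-elim (<⇒≢ x<q (inj x q x<m q<m e))
    ... | tri> _ _ gt = ⊥-elim (avoid132 p x q p<x x<q q<m vp<vq gt)
    above : v p < v x
    above with <-cmp (v p) (v x)
    ... | tri< lt _ _ = lt
    ... | tri≈ _ e _ = ⊥-elim (<⇒≢ p<x (inj p x p<m x<m e))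
    ... | tri> _ _ gt = ⊥-elim (avoid213 p x q p<x x<q q<m gt vp<vq)

  <⇒ascents : ∀ p q → p < q → q < m → v p < v q → ∀ x → p ≤ x → x < q → v x < v (suc x)
  <⇒ascents p q p<q q<m vp<vq x p≤x x<q = step (vx<vq (m≤n⇒m<n∨m≡n p≤x))
    where
    vx<vq : p < x ⊎ p ≡ x → v x < v q
    vx<vq (inj₁ p<x) = proj₂ (sandwiched p x q p<x x<q q<m vp<vq)
    vx<vq (inj₂ refl) = vp<vq
    step : v x < v q → v x < v (suc x)
    step vx<vq with m≤n⇒m<n∨m≡n x<q
    ... | inj₁ sx<q = proj₁ (sandwiched x (suc x) q ≤-refl sx<q q<m vx<vq)
    ... | inj₂ refl = vx<vq

  ascent⇒no-descent : ∀ x → v x < v (suc x) → descent v x ≡ false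
  ascent⇒no-descent x lt = <ᵇ-false (<-asym lt)

  no-descent⇒ascent : ∀ x → suc x < m → descent v x ≡ false → v x < v (suc x)
  no-descent⇒ascent x sx<m e = ≤∧≢⇒< (≮⇒≥ (<ᵇ-false⁻ e))
    (λ eq → <⇒≢ ≤-refl (inj x (suc x) (<-trans ≤-refl sx<m) sx<m eq))

  <⇒same-run : ∀ p q → p < q → q < m → v p < v q → count q (descent v) ≡ count p (descent v)
  <⇒same-run p q p<q q<m lt = vanishes⇒flat p q (descent v) (<⇒≤ p<q)
    (λ x p≤x x<q → ascent⇒no-descent x (<⇒ascents p q p<q q<m lt x p≤x x<q))

  same-run⇒< : ∀ p q → p < q → q < m → count q (descent v) ≡ count p (descent v) → v p < v q
  same-run⇒< p q p<q q<m e = ascents⇒< v p q (λ x p≤x x<q → no-descent⇒ascent x (≤-<-trans x<q q<m)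
    (flat⇒vanishes p q (descent v) (<⇒≤ p<q) e x p≤x x<q)) p<q

lex-<⇐ : ∀ m a c x y → x < m → a < c ⊎ (a ≡ c × x < y) → a * m + x < c * m + y
lex-<⇐ m a c x y x<m (inj₁ a<c) = begin-strict
  a * m + x <⟨ +-monoʳ-< (a * m) x<m ⟩
  a * m + m ≡⟨ +-comm (a * m) m ⟩
  suc a * m ≤⟨ *-monoˡ-≤ m a<c ⟩
  c * m     ≤⟨ m≤m+n (c * m) y ⟩
  c * m + y ∎
  where open ≤-Reasoning
lex-<⇐ m a c x y x<m (inj₂ (refl , x<y)) = +-monoʳ-< (a * m) x<y

lex-<⇒ : ∀ m a c x y → x < m → y < m → a * m + x < c * m + y → a < c ⊎ (a ≡ c × x < y)
lex-<⇒ m a c x y x<m y<m lt with <-cmp a c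
... | tri< a<c _ _ = inj₁ a<c
... | tri≈ _ refl _ = inj₂ (refl , +-cancelˡ-< (a * m) x y lt)
... | tri> _ _ c<a = ⊥-elim (<-asym lt (lex-<⇐ m c a y x y<m (inj₁ c<a)))

lex-injʳ : ∀ m a c x y → x < m → y < m → a * m + x ≡ c * m + y → x ≡ y
lex-injʳ m a c x y x<m y<m e with <-cmp a c
... | tri< a<c _ _ = ⊥-elim (<⇒≢ (lex-<⇐ m a c x y x<m (inj₁ a<c)) e)
... | tri≈ _ refl _ = +-cancelˡ-≡ (a * m) x y e
... | tri> _ _ c<a = ⊥-elim (<⇒≢ (lex-<⇐ m c a y x y<m (inj₁ c<a)) (sym e))

module Rank (m : ℕ) (key : ℕ → ℕ)
  (key-inj : ∀ p q → p < m → q < m → key p ≡ key q → p ≡ q) where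

  rank : ℕ → ℕ
  rank j = count m (λ q → key q <ᵇ key j)

  rank<m : ∀ j → j < m → rank j < m
  rank<m j j<m = count<n m _ j j<m (<ᵇ-false (n≮n (key j)))

  rank-mono : ∀ p q → p < m → key p < key q → rank p < rank q
  rank-mono p q p<m lt = count-⇒-strict m _ _
    (λ i _ e → <ᵇ-true (<-trans (<ᵇ-true⁻ e) lt)) p p<m (<ᵇ-false (n≮n (key p))) (<ᵇ-true lt)

  rank-reflect : ∀ p q → p < m → q < m → rank p < rank q → key p < key q
  rank-reflect p q p<m q<m lt with <-cmp (key p) (key q)
  ... | tri< kp<kq _ _ = kp<kq
  ... | tri≈ _ e _ with refl ← key-inj p q p<m q<m e = ⊥-elim (<-irrefl refl lt)
  ... | tri> _ _ kq<kp = ⊥-elim (<-asym lt (rank-mono q p q<m kq<kp))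

  rank-inj : ∀ p q → p < m → q < m → rank p ≡ rank q → p ≡ q
  rank-inj p q p<m q<m e with <-cmp (key p) (key q)
  ... | tri< kp<kq _ _ = ⊥-elim (<⇒≢ (rank-mono p q p<m kp<kq) e)
  ... | tri≈ _ e′ _ = key-inj p q p<m q<m e′
  ... | tri> _ _ kq<kp = ⊥-elim (<⇒≢ (rank-mono q p q<m kq<kp) (sym e))

-- Given a descent indicator D on [0, N), order the positions of [0, N] first by
-- decreasing number B p of descents before p, then by increasing position.  The
-- rank π for this order is the sequence with increasing runs of consecutive
-- values arranged in decreasing order; it avoids 132 and has descent set D.
module DescentPerm (N : ℕ) (D : ℕ → Bool) where
  m : ℕ
  m = suc N

  B : ℕ → ℕ
  B p = count p D

  total : ℕ
  total = count N D

  key : ℕ → ℕ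
  key p = (total ∸ B p) * m + p

  B≤total : ∀ p → p ≤ N → B p ≤ total
  B≤total p p≤N = count-mono p N D p≤N

  B-mono : ∀ p q → p ≤ q → B p ≤ B q
  B-mono p q = count-mono p q D

  key-inj : ∀ p q → p < m → q < m → key p ≡ key q → p ≡ q
  key-inj p q p<m q<m = lex-injʳ m (total ∸ B p) (total ∸ B q) p q p<m q<m

  _≺_ : ℕ → ℕ → Set
  q ≺ j = B j < B q ⊎ (B q ≡ B j × q < j)

  key<⇒≺ : ∀ q j → q < m → j < m → key q < key j → q ≺ j
  key<⇒≺ q j q<m j<m lt with lex-<⇒ m _ _ q j q<m j<m lt
  ... | inj₁ a = inj₁ (≰⇒> (λ Bq≤Bj → <⇒≱ a (∸-monoʳ-≤ total Bq≤Bj)))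
  ... | inj₂ (e , q<j) = inj₂ (∸-cancelˡ-≡ (B≤total q (≤-pred q<m)) (B≤total j (≤-pred j<m)) e , q<j)

  ≺⇒key< : ∀ q j → q < m → q ≺ j → key q < key j
  ≺⇒key< q j q<m (inj₁ a) = lex-<⇐ m _ _ q j q<m (inj₁ (∸-monoʳ-< a (B≤total q (≤-pred q<m))))
  ≺⇒key< q j q<m (inj₂ (e , q<j)) = lex-<⇐ m _ _ q j q<m (inj₂ (cong (total ∸_) e , q<j))

  open Rank m key key-inj public

  π : ℕ → ℕ
  π = rank

  π-avoids132 : ∀ i j k → i < j → j < k → k < m → π i < π k → π k < π j → ⊥
  π-avoids132 i j k i<j j<k k<m πi<πk πk<πj = absurd
    (key<⇒≺ i k i<m k<m (rank-reflect i k i<m k<m πi<πk))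
    (key<⇒≺ k j k<m j<m (rank-reflect k j k<m j<m πk<πj))
    where
    j<m : j < m
    j<m = <-trans j<k k<m
    i<m : i < m
    i<m = <-trans i<j j<m
    Bi≤Bj : B i ≤ B j
    Bi≤Bj = B-mono i j (<⇒≤ i<j)
    Bj≤Bk : B j ≤ B k
    Bj≤Bk = B-mono j k (<⇒≤ j<k)
    absurd : i ≺ k → k ≺ j → ⊥
    absurd (inj₁ Bk<Bi) _ = <⇒≱ Bk<Bi (≤-trans Bi≤Bj Bj≤Bk)
    absurd (inj₂ (Bi≡Bk , _)) (inj₁ Bj<Bk) = <⇒≱ Bj<Bk (subst (_≤ B j) Bi≡Bk Bi≤Bj)
    absurd (inj₂ _) (inj₂ (_ , k<j)) = <-asym k<j j<k

  π-descent : ∀ x → suc x < m → descent π x ≡ D x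
  π-descent x sx<m with D x in Dx
  ... | true = <ᵇ-true (rank-mono (suc x) x sx<m (≺⇒key< (suc x) x sx<m (inj₁ Bx<Bsx)))
    where
    Bx<Bsx : B x < B (suc x)
    Bx<Bsx = subst (B x <_) (sym (trans (count-snoc x D) (cong (λ b → B x + χ b) Dx)))
      (subst (_< B x + 1) (+-identityʳ (B x)) (+-monoʳ-< (B x) z<s))
  ... | false = <ᵇ-false (λ lt → absurd (key<⇒≺ (suc x) x sx<m x<m (rank-reflect (suc x) x sx<m x<m lt)))
    where
    x<m : x < m
    x<m = <-trans ≤-refl sx<m
    Bsx≡Bx : B (suc x) ≡ B x
    Bsx≡Bx = trans (count-snoc x D) (trans (cong (λ b → B x + χ b) Dx) (+-identityʳ _))
    absurd : suc x ≺ x → ⊥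
    absurd (inj₁ Bx<Bsx) = <-irrefl (sym Bsx≡Bx) Bx<Bsx
    absurd (inj₂ (_ , sx<x)) = <-asym sx<x ≤-refl

at : ∀ {m} {A : Set} → (Fin m → A) → A → ℕ → A
at {zero} f d x = d
at {suc m} f d zero = f Fin.zero
at {suc m} f d (suc x) = at (λ i → f (Fin.suc i)) d x

at-toℕ : ∀ {m} {A : Set} (f : Fin m → A) d (i : Fin m) → at f d (toℕ i) ≡ f i
at-toℕ f d Fin.zero = refl
at-toℕ f d (Fin.suc i) = at-toℕ (λ i → f (Fin.suc i)) d i

at-fromℕ< : ∀ {m} {A : Set} (f : Fin m → A) d x (x<m : x < m) → at f d x ≡ f (fromℕ< x<m)
at-fromℕ< f d x x<m = trans (cong (at f d) (sym (toℕ-fromℕ< x<m))) (at-toℕ f d (fromℕ< x<m))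

-- Injective endofunctions of Fin m are surjective (pigeonhole).
fin-surjective : ∀ {m} (σ : Fin m → Fin m) → (∀ i j → σ i ≡ σ j → i ≡ j) → ∀ w → ∃ λ i → σ i ≡ w
fin-surjective {suc m} σ inj w with any? (λ i → σ i Finᵖ.≟ w)
... | yes hit = hit
... | no miss = ⊥-elim (<-irrefl refl (injective⇒≤ {f = σ′} σ′-inj))
  where
  avoids : ∀ i → w ≢ σ i
  avoids i e = miss (i , sym e)
  σ′ : Fin (suc m) → Fin m
  σ′ i = punchOut (avoids i)
  σ′-inj : ∀ {i j} → σ′ i ≡ σ′ j → i ≡ j
  σ′-inj {i} {j} e = inj i j (punchOut-injective (avoids i) (avoids j) e)

surjective : ∀ m (v : ℕ → ℕ) → (∀ x → x < m → v x < m) →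
  (∀ x y → x < m → y < m → v x ≡ v y → x ≡ y) → ∀ y → y < m → ∃ λ x → x < m × v x ≡ y
surjective m v range inj y y<m with fin-surjective σ σ-inj (fromℕ< y<m)
  where
  σ : Fin m → Fin m
  σ i = fromℕ< (range (toℕ i) (toℕ<n i))
  σ-inj : ∀ i j → σ i ≡ σ j → i ≡ j
  σ-inj i j e = toℕ-injective (inj (toℕ i) (toℕ j) (toℕ<n i) (toℕ<n j)
    (trans (sym (toℕ-fromℕ< (range (toℕ i) (toℕ<n i))))
      (trans (cong toℕ e) (toℕ-fromℕ< (range (toℕ j) (toℕ<n j))))))
... | i , e = toℕ i , toℕ<n i ,
  trans (sym (toℕ-fromℕ< (range (toℕ i) (toℕ<n i)))) (trans (cong toℕ e) (toℕ-fromℕ< y<m))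

𝟙 : ∀ {P : Set} → Dec P → ℕ
𝟙 d = χ (does d)

𝟙-cong : ∀ {P Q : Set} (p : Dec P) (q : Dec Q) → (P → Q) → (Q → P) → 𝟙 p ≡ 𝟙 q
𝟙-cong (yes _) (yes _) _ _ = refl
𝟙-cong (no _) (no _) _ _ = refl
𝟙-cong (yes p) (no ¬q) to _ = ⊥-elim (¬q (to p))
𝟙-cong (no ¬p) (yes q) _ from = ⊥-elim (¬p (from q))

𝟙-yes : ∀ {P : Set} (p : Dec P) → P → 𝟙 p ≡ 1
𝟙-yes p x = cong χ (dec-true p x)

𝟙-no : ∀ {P : Set} (p : Dec P) → ¬ P → 𝟙 p ≡ 0
𝟙-no p ¬x = cong χ (dec-false p ¬x)

sumOver : ∀ {A : Set} → List A → (A → ℕ) → ℕ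
sumOver [] h = 0
sumOver (x ∷ xs) h = h x + sumOver xs h

sumOver-cong : ∀ {A : Set} xs (h g : A → ℕ) → (∀ x → h x ≡ g x) → sumOver xs h ≡ sumOver xs g
sumOver-cong [] h g h≗g = refl
sumOver-cong (x ∷ xs) h g h≗g = cong₂ _+_ (h≗g x) (sumOver-cong xs h g h≗g)

sumOver-0 : ∀ {A : Set} (xs : List A) → sumOver xs (λ _ → 0) ≡ 0
sumOver-0 [] = refl
sumOver-0 (x ∷ xs) = sumOver-0 xs

sumOver-++ : ∀ {A : Set} xs ys (h : A → ℕ) → sumOver (xs ++ ys) h ≡ sumOver xs h + sumOver ys h
sumOver-++ [] ys h = refl
sumOver-++ (x ∷ xs) ys h = trans (cong (h x +_) (sumOver-++ xs ys h)) (sym (+-assoc (h x) _ _))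

sumOver-map : ∀ {A B : Set} (g : A → B) xs (h : B → ℕ) →
  sumOver (map g xs) h ≡ sumOver xs (λ x → h (g x))
sumOver-map g [] h = refl
sumOver-map g (x ∷ xs) h = cong (h (g x) +_) (sumOver-map g xs h)

sumOver-concatMap : ∀ {A B : Set} (g : A → List B) xs (h : B → ℕ) →
  sumOver (concatMap g xs) h ≡ sumOver xs (λ x → sumOver (g x) h)
sumOver-concatMap g [] h = refl
sumOver-concatMap g (x ∷ xs) h =
  trans (sumOver-++ (g x) (concatMap g xs) h) (cong (sumOver (g x) h +_) (sumOver-concatMap g xs h))

sumOver-+ : ∀ {A : Set} xs (f g : A → ℕ) →
  sumOver xs (λ x → f x + g x) ≡ sumOver xs f + sumOver xs g
sumOver-+ [] f g = refl
sumOver-+ (x ∷ xs) f g =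
  trans (cong (f x + g x +_) (sumOver-+ xs f g)) (+-interchange (f x) (g x) _ _)

sumOver-swap : ∀ {A B : Set} xs ys (h : A → B → ℕ) →
  sumOver xs (λ x → sumOver ys (h x)) ≡ sumOver ys (λ y → sumOver xs (λ x → h x y))
sumOver-swap [] ys h = sym (sumOver-0 ys)
sumOver-swap (x ∷ xs) ys h = trans (cong (sumOver ys (h x) +_) (sumOver-swap xs ys h))
  (sym (sumOver-+ ys (h x) (λ y → sumOver xs (λ x → h x y))))

length-filter : ∀ {A : Set} {P : A → Set} (P? : ∀ x → Dec (P x)) xs →
  length (filter P? xs) ≡ sumOver xs (λ x → 𝟙 (P? x))
length-filter P? [] = refl
length-filter P? (x ∷ xs) with does (P? x)
... | true = cong suc (length-filter P? xs)
... | false = length-filter P? xs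

count-bijection : ∀ {A B : Set} (xs : List A) (ys : List B)
  (_≈_ : A → A → Set) (_≈?_ : ∀ a a′ → Dec (a ≈ a′)) (_≟_ : ∀ (b b′ : B) → Dec (b ≡ b′))
  {P : A → Set} {Q : B → Set} (P? : ∀ a → Dec (P a)) (Q? : ∀ b → Dec (Q b))
  (enc : A → B) (dec : B → A) →
  (∀ a → sumOver xs (λ x → 𝟙 (x ≈? a)) ≡ 1) →
  (∀ b → sumOver ys (λ y → 𝟙 (y ≟ b)) ≡ 1) →
  (∀ a a′ → a ≈ a′ → P a′ → P a) →
  (∀ a a′ → a ≈ a′ → enc a ≡ enc a′) →
  (∀ b → enc (dec b) ≡ b) →
  (∀ b → Q b → P (dec b)) →
  (∀ a → P a → a ≈ dec (enc a) × Q (enc a)) →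
  length (filter P? xs) ≡ length (filter Q? ys)
count-bijection xs ys _≈_ _≈?_ _≟_ {P} {Q} P? Q? enc dec
  xs-once ys-once P-resp enc-resp enc-dec Q⇒P P⇒ = begin
  length (filter P? xs)                                  ≡⟨ length-filter P? xs ⟩
  sumOver xs (λ a → 𝟙 (P? a))                            ≡⟨ sumOver-cong xs _ _ fibre-over-a ⟩
  sumOver xs (λ a → sumOver ys (λ b → 𝟙 (match a b)))    ≡⟨ sumOver-swap xs ys (λ a b → 𝟙 (match a b)) ⟩
  sumOver ys (λ b → sumOver xs (λ a → 𝟙 (match a b)))    ≡⟨ sumOver-cong ys _ _ fibre-over-b ⟩
  sumOver ys (λ b → 𝟙 (Q? b))                            ≡⟨ length-filter Q? ys ⟨
  length (filter Q? ys)                                  ∎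
  where
  open ≡-Reasoning
  match : ∀ a b → Dec (a ≈ dec b × Q b)
  match a b = (a ≈? dec b) ×-dec Q? b
  fibre-over-a : ∀ a → 𝟙 (P? a) ≡ sumOver ys (λ b → 𝟙 (match a b))
  fibre-over-a a with P? a
  ... | yes pa = sym (trans (sumOver-cong ys _ _ (λ b → 𝟙-cong (match a b) (b ≟ enc a)
        (λ (a≈db , _) → trans (sym (enc-dec b)) (sym (enc-resp a (dec b) a≈db)))
        (λ { refl → P⇒ a pa })))
      (ys-once (enc a)))
  ... | no ¬pa = sym (trans (sumOver-cong ys _ _ (λ b → 𝟙-no (match a b)
        (λ (a≈db , qb) → ¬pa (P-resp a (dec b) a≈db (Q⇒P b qb)))))
      (sumOver-0 ys))
  fibre-over-b : ∀ b → sumOver xs (λ a → 𝟙 (match a b)) ≡ 𝟙 (Q? b)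
  fibre-over-b b = fibre (Q? b)
    where
    fibre : (d : Dec (Q b)) → sumOver xs (λ a → 𝟙 ((a ≈? dec b) ×-dec d)) ≡ 𝟙 d
    fibre (yes qb) = trans (sumOver-cong xs _ _ (λ a →
        𝟙-cong ((a ≈? dec b) ×-dec yes qb) (a ≈? dec b) proj₁ (_, qb)))
      (xs-once (dec b))
    fibre (no ¬qb) = trans (sumOver-cong xs _ _ (λ a →
        𝟙-no ((a ≈? dec b) ×-dec no ¬qb) (λ x → ¬qb (proj₂ x))))
      (sumOver-0 xs)

sumOver-tabulate : ∀ {L} {A : Set} (g : Fin L → A) (p : A → Bool) →
  sumOver (tabulate g) (λ x → χ (p x)) ≡ count L (at (λ i → p (g i)) false)
sumOver-tabulate {zero} g p = refl
sumOver-tabulate {suc L} g p = cong (χ (p (g Fin.zero)) +_) (sumOver-tabulate (λ i → g (Fin.suc i)) p)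

allFin-once : ∀ {m} (a₀ : Fin m) → sumOver (allFin m) (λ a → 𝟙 (a Finᵖ.≟ a₀)) ≡ 1
allFin-once {m} a₀ = trans (sumOver-tabulate (λ i → i) (λ a → does (a Finᵖ.≟ a₀)))
  (count≡1 m _ (toℕ a₀) (toℕ<n a₀) (trans (at-toℕ _ false a₀) (dec-true (a₀ Finᵖ.≟ a₀) refl))
    (λ i i<m e → trans (sym (toℕ-fromℕ< i<m))
      (cong toℕ (≟-true⁻ (trans (sym (at-fromℕ< _ false i i<m)) e)))))
  where
  ≟-true⁻ : ∀ {a b : Fin m} → does (a Finᵖ.≟ b) ≡ true → a ≡ b
  ≟-true⁻ {a} {b} e with a Finᵖ.≟ b
  ... | yes a≡b = a≡b

_≗ᶠ_ : ∀ {k m} → (Fin k → Fin m) → (Fin k → Fin m) → Set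
f ≗ᶠ g = ∀ i → f i ≡ g i

_≗ᶠ?_ : ∀ {k m} (f g : Fin k → Fin m) → Dec (f ≗ᶠ g)
f ≗ᶠ? g = all? (λ i → f i Finᵖ.≟ g i)

allFuns-once : ∀ m k (g : Fin k → Fin m) → sumOver (allFuns m k) (λ f → 𝟙 (f ≗ᶠ? g)) ≡ 1
allFuns-once m zero g = 𝟙-yes ((λ ()) ≗ᶠ? g) (λ ())
allFuns-once m (suc k) g = step _ (λ a f → refl) (λ a f i → refl)
  where
  -- Stated for an arbitrary "cons" so that the local one of allFuns can be used.
  step : (cons : Fin m → (Fin k → Fin m) → Fin (suc k) → Fin m) →
         (∀ a f → cons a f Fin.zero ≡ a) → (∀ a f i → cons a f (Fin.suc i) ≡ f i) →
         sumOver (concatMap (λ f → map (λ a → cons a f) (allFin m)) (allFuns m k))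
           (λ f → 𝟙 (f ≗ᶠ? g)) ≡ 1
  step cons cons-zero cons-suc = trans (sumOver-concatMap _ (allFuns m k) _)
    (trans (sumOver-cong (allFuns m k) _ _ heads) (allFuns-once m k (λ i → g (Fin.suc i))))
    where
    g′ : Fin k → Fin m
    g′ = λ i → g (Fin.suc i)
    heads : ∀ f → sumOver (map (λ a → cons a f) (allFin m)) (λ f → 𝟙 (f ≗ᶠ? g)) ≡ 𝟙 (f ≗ᶠ? g′)
    heads f = fibre (f ≗ᶠ? g′)
      where
      fibre : (d : Dec (f ≗ᶠ g′)) →
        sumOver (map (λ a → cons a f) (allFin m)) (λ f → 𝟙 (f ≗ᶠ? g)) ≡ 𝟙 d
      fibre (yes f≗g′) = trans (sumOver-map _ (allFin m) _) (trans (sumOver-cong (allFin m) _ _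
          (λ a → 𝟙-cong (cons a f ≗ᶠ? g) (a Finᵖ.≟ g Fin.zero)
             (λ c≗g → trans (sym (cons-zero a f)) (c≗g Fin.zero))
             (λ { refl Fin.zero → cons-zero a f ; refl (Fin.suc i) → trans (cons-suc a f i) (f≗g′ i) })))
          (allFin-once (g Fin.zero)))
      fibre (no f≉g′) = trans (sumOver-map _ (allFin m) _) (trans (sumOver-cong (allFin m) _ _
          (λ a → 𝟙-no (cons a f ≗ᶠ? g)
            (λ c≗g → f≉g′ (λ i → trans (sym (cons-suc a f i)) (c≗g (Fin.suc i))))))
          (sumOver-0 (allFin m)))

allBits : ∀ n → List (Vec Bool n)
allBits zero = Vec.[] ∷ []
allBits (suc n) = map (false Vec.∷_) (allBits n) ++ map (true Vec.∷_) (allBits n)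

_≟ᵇᵛ_ : ∀ {n} (a b : Vec Bool n) → Dec (a ≡ b)
_≟ᵇᵛ_ = Vecᵖ.≡-dec Boolᵖ._≟_

allBits-once : ∀ n (b₀ : Vec Bool n) → sumOver (allBits n) (λ b → 𝟙 (b ≟ᵇᵛ b₀)) ≡ 1
allBits-once zero Vec.[] = refl
allBits-once (suc n) (x Vec.∷ b₀) = trans (sumOver-++ (map (false Vec.∷_) (allBits n)) _ _)
  (trans (cong₂ _+_ (sumOver-map _ (allBits n) _) (sumOver-map _ (allBits n) _)) (split x))
  where
  same-head : ∀ y → sumOver (allBits n) (λ b → 𝟙 ((y Vec.∷ b) ≟ᵇᵛ (y Vec.∷ b₀))) ≡ 1
  same-head y = trans (sumOver-cong (allBits n) _ _ (λ b →
      𝟙-cong ((y Vec.∷ b) ≟ᵇᵛ (y Vec.∷ b₀)) (b ≟ᵇᵛ b₀) (λ { refl → refl }) (cong (y Vec.∷_))))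
    (allBits-once n b₀)
  other-head : ∀ y z → y ≢ z → sumOver (allBits n) (λ b → 𝟙 ((y Vec.∷ b) ≟ᵇᵛ (z Vec.∷ b₀))) ≡ 0
  other-head y z y≢z = trans (sumOver-cong (allBits n) _ _ (λ b →
      𝟙-no ((y Vec.∷ b) ≟ᵇᵛ (z Vec.∷ b₀)) (λ { refl → y≢z refl })))
    (sumOver-0 (allBits n))
  split : ∀ x → sumOver (allBits n) (λ b → 𝟙 ((false Vec.∷ b) ≟ᵇᵛ (x Vec.∷ b₀))) +
                sumOver (allBits n) (λ b → 𝟙 ((true Vec.∷ b) ≟ᵇᵛ (x Vec.∷ b₀))) ≡ 1
  split false = cong₂ _+_ (same-head false) (other-head true false (λ ()))
  split true = cong₂ _+_ (other-head false true (λ ())) (same-head true)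

-- For a permutation v of [0, m), v j is the number of q < m with v q < v j.
-- This lets us identify a permutation with the ranking by any key inducing the
-- same order.
module SelfRank (m : ℕ) (v : ℕ → ℕ)
  (range : ∀ x → x < m → v x < m)
  (inj : ∀ x y → x < m → y < m → v x ≡ v y → x ≡ y) where

  below : ℕ → ℕ
  below y = count m (λ x → v x <ᵇ y)

  <ᵇ-suc : ∀ a y → χ (a <ᵇ suc y) ≡ χ (a <ᵇ y) + χ (a ≡ᵇ y)
  <ᵇ-suc a y with <-cmp a y
  ... | tri< a<y _ _ rewrite <ᵇ-true a<y | <ᵇ-true (m<n⇒m<1+n a<y) | ≡ᵇ-false (<⇒≢ a<y) = refl
  ... | tri≈ _ refl _ rewrite <ᵇ-false (n≮n a) | <ᵇ-true (n<1+n a) | ≡ᵇ-true (refl {x = a}) = refl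
  ... | tri> _ _ y<a rewrite <ᵇ-false (<-asym y<a) | <ᵇ-false {a} {suc y} (λ a<sy → <⇒≱ y<a (≤-pred a<sy))
                           | ≡ᵇ-false (>⇒≢ y<a) = refl

  -- Each value y < m is taken exactly once.
  below-suc : ∀ y → y < m → below (suc y) ≡ below y + 1
  below-suc y y<m with surjective m v range inj y y<m
  ... | x₀ , x₀<m , vx₀≡y = trans (count-sum m _ _ (λ x → v x ≡ᵇ y) (λ i _ → <ᵇ-suc (v i) y))
    (cong (below y +_) (count≡1 m _ x₀ x₀<m (≡ᵇ-true vx₀≡y)
      (λ i i<m e → inj i x₀ i<m x₀<m (trans (≡ᵇ-true⁻ e) (sym vx₀≡y)))))

  below-id : ∀ y → y ≤ m → below y ≡ y
  below-id zero _ = ⇒count≡0 m _ (λ i _ → <ᵇ-false {v i} {0} (λ ()))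
  below-id (suc y) sy≤m = trans (below-suc y sy≤m)
    (trans (cong (_+ 1) (below-id y (<⇒≤ sy≤m))) (+-comm y 1))

  value≡rank : ∀ j → j < m → v j ≡ count m (λ q → v q <ᵇ v j)
  value≡rank j j<m = sym (below-id (v j) (<⇒≤ (range j j<m)))

-- If D is symmetric under x ↦ N-1-x, the reversal p ↦ N-p reverses the order
-- ≺, hence π (N - p) = N - π p.
module Symmetric (N : ℕ) (D : ℕ → Bool) (D-sym : ∀ x → x < N → D (N ∸ suc x) ≡ D x) where
  open DescentPerm N D

  -- The descents before N-p mirror those at or after p.
  B-reverse : ∀ p → p ≤ N → B (N ∸ p) + B p ≡ total
  B-reverse p p≤N = sym (begin
    count N D                                          ≡⟨ cong (λ z → count z D) (m∸n+n≡m p≤N) ⟨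
    count ((N ∸ p) + p) D                              ≡⟨ count-+ (N ∸ p) p D ⟩
    B (N ∸ p) + count p (λ i → D ((N ∸ p) + i))        ≡⟨ cong (B (N ∸ p) +_) (count-reverse p _) ⟩
    B (N ∸ p) + count p (λ i → D ((N ∸ p) + (p ∸ suc i)))
      ≡⟨ cong (B (N ∸ p) +_) (count-cong p _ _ (λ i i<p →
           trans (cong D (mirror i i<p)) (D-sym i (<-≤-trans i<p p≤N)))) ⟩
    B (N ∸ p) + B p                                    ∎)
    where
    open ≡-Reasoning
    mirror : ∀ i → i < p → (N ∸ p) + (p ∸ suc i) ≡ N ∸ suc i
    mirror i i<p = trans (sym (+-∸-assoc (N ∸ p) i<p)) (cong (_∸ suc i) (m∸n+n≡m p≤N))

  B-opp : ∀ p → p ≤ N → B (N ∸ p) ≡ total ∸ B p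
  B-opp p p≤N = trans (sym (m+n∸n≡m (B (N ∸ p)) (B p))) (cong (_∸ B p) (B-reverse p p≤N))

  B-opp′ : ∀ p → p ≤ N → total ∸ B (N ∸ p) ≡ B p
  B-opp′ p p≤N = trans (cong (total ∸_) (B-opp p p≤N)) (m∸[m∸n]≡n (B≤total p p≤N))

  N∸<m : ∀ x → N ∸ x < m
  N∸<m x = s≤s (m∸n≤m N x)

  ≺-reverse : ∀ q j → q < m → j < m → (N ∸ j) ≺ (N ∸ q) → q ≺ j
  ≺-reverse q j q<m j<m (inj₁ lt) = inj₁ (∸-<-reflect total (B q) (B j)
    (subst₂ _<_ (B-opp q (≤-pred q<m)) (B-opp j (≤-pred j<m)) lt))
  ≺-reverse q j q<m j<m (inj₂ (e , lt)) =
    inj₂ (trans (sym (B-opp′ q (≤-pred q<m))) (trans (cong (total ∸_) (sym e)) (B-opp′ j (≤-pred j<m))) ,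
          ∸-<-reflect N j q lt)

  ≺-reverse⁻ : ∀ q j → q < m → j < m → q ≺ j → (N ∸ j) ≺ (N ∸ q)
  ≺-reverse⁻ q j q<m j<m (inj₁ lt) = inj₁ (subst₂ _<_ (sym (B-opp q (≤-pred q<m))) (sym (B-opp j (≤-pred j<m)))
    (∸-monoʳ-< lt (B≤total q (≤-pred q<m))))
  ≺-reverse⁻ q j q<m j<m (inj₂ (e , lt)) =
    inj₂ (trans (B-opp j (≤-pred j<m)) (trans (cong (total ∸_) (sym e)) (sym (B-opp q (≤-pred q<m)))) ,
          ∸-monoʳ-< lt (≤-pred j<m))

  π≤N : ∀ j → j < m → π j ≤ N
  π≤N j j<m = ≤-pred (rank<m j j<m)

  -- The conjugate of π by the reversal; it turns out to be π itself.
  τ : ℕ → ℕ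
  τ x = N ∸ π (N ∸ x)

  τ-range : ∀ x → x < m → τ x < m
  τ-range x _ = N∸<m (π (N ∸ x))

  τ-inj : ∀ x y → x < m → y < m → τ x ≡ τ y → x ≡ y
  τ-inj x y x<m y<m e = ∸-cancelˡ-≡ (≤-pred x<m) (≤-pred y<m)
    (rank-inj (N ∸ x) (N ∸ y) (N∸<m x) (N∸<m y) (∸-cancelˡ-≡ (π≤N _ (N∸<m x)) (π≤N _ (N∸<m y)) e))

  -- τ induces the same order as the key, so it is the same ranking.
  τ≡π : ∀ j → j < m → τ j ≡ π j
  τ≡π j j<m = trans (SelfRank.value≡rank m τ τ-range τ-inj j j<m)
    (count-cong m _ _ (λ q q<m → <ᵇ-cong (to q q<m) (from q q<m)))
    where
    to : ∀ q → q < m → τ q < τ j → key q < key j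
    to q q<m lt = ≺⇒key< q j q<m (≺-reverse q j q<m j<m (key<⇒≺ (N ∸ j) (N ∸ q) (N∸<m j) (N∸<m q)
      (rank-reflect (N ∸ j) (N ∸ q) (N∸<m j) (N∸<m q) (∸-<-reflect N _ _ lt))))
    from : ∀ q → q < m → key q < key j → τ q < τ j
    from q q<m lt = ∸-monoʳ-< (rank-mono (N ∸ j) (N ∸ q) (N∸<m j)
      (≺⇒key< (N ∸ j) (N ∸ q) (N∸<m j) (≺-reverse⁻ q j q<m j<m (key<⇒≺ q j q<m j<m lt))))
      (π≤N _ (N∸<m q))

  π-centrosymmetric : ∀ j → j ≤ N → π j + π (N ∸ j) ≡ N
  π-centrosymmetric j j≤N = trans (cong (_+ π (N ∸ j)) (sym (τ≡π j (s≤s j≤N))))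
    (m∸n+n≡m (π≤N _ (N∸<m j)))

π-cong : ∀ N D D′ → (∀ x → x < N → D x ≡ D′ x) → ∀ j → j < suc N →
  DescentPerm.π N D j ≡ DescentPerm.π N D′ j
π-cong N D D′ D≗D′ j j<m =
  count-cong (suc N) _ _ (λ q q<m → cong₂ _<ᵇ_ (key-cong q (≤-pred q<m)) (key-cong j (≤-pred j<m)))
  where
  B-cong : ∀ p → p ≤ N → count p D ≡ count p D′
  B-cong p p≤N = count-cong p D D′ (λ x x<p → D≗D′ x (<-≤-trans x<p p≤N))
  key-cong : ∀ p → p ≤ N → DescentPerm.key N D p ≡ DescentPerm.key N D′ p
  key-cong p p≤N = cong (λ z → z * suc N + p) (cong₂ _∸_ (B-cong N ≤-refl) (B-cong p p≤N))

module AsSequence (N : ℕ) (σ : Fun (suc N)) where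
  m : ℕ
  m = suc N

  v : ℕ → ℕ
  v = at (λ i → toℕ (σ i)) 0

  v-fromℕ< : ∀ x (x<m : x < m) → v x ≡ toℕ (σ (fromℕ< x<m))
  v-fromℕ< x x<m = at-fromℕ< _ 0 x x<m

  v-toℕ : ∀ i → v (toℕ i) ≡ toℕ (σ i)
  v-toℕ i = at-toℕ _ 0 i

  v-range : ∀ x → x < m → v x < m
  v-range x x<m = subst (_< m) (sym (v-fromℕ< x x<m)) (toℕ<n _)

  des≡count : des σ ≡ count N (descent v)
  des≡count = begin
    des σ                                         ≡⟨ length-filter descent? (allFin N) ⟩
    sumOver (allFin N) (λ i → 𝟙 (descent? i))     ≡⟨ sumOver-tabulate (λ i → i) (λ i → does (descent? i)) ⟩
    count N (at (λ i → does (descent? i)) false)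
      ≡⟨ count-cong N _ _ (λ x x<N → trans (at-fromℕ< _ false x x<N) (sym (descent-at x x<N))) ⟩
    count N (descent v)                           ∎
    where
    open ≡-Reasoning
    descent-at : ∀ x (x<N : x < N) →
      descent v x ≡ (toℕ (σ (Fin.suc (fromℕ< x<N))) <ᵇ toℕ (σ (inject₁ (fromℕ< x<N))))
    descent-at x x<N = cong₂ _<ᵇ_
      (trans (cong (λ z → v (suc z)) (sym (toℕ-fromℕ< x<N))) (v-toℕ (Fin.suc (fromℕ< x<N))))
      (trans (cong v (trans (sym (toℕ-fromℕ< x<N)) (sym (toℕ-inject₁ (fromℕ< x<N))))) (v-toℕ _))
    descent? : ∀ i → Dec (σ (Fin.suc i) Fin.< σ (inject₁ i))
    descent? i = σ (Fin.suc i) Finᵖ.<? σ (inject₁ i)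

sequence-cong : ∀ {N} {σ τ : Fun (suc N)} → (∀ i → σ i ≡ τ i) →
  ∀ x → AsSequence.v N σ x ≡ AsSequence.v N τ x
sequence-cong {N} {σ} {τ} σ≗τ x with x <? suc N
... | yes x<m = trans (AsSequence.v-fromℕ< N σ x x<m)
  (trans (cong toℕ (σ≗τ _)) (sym (AsSequence.v-fromℕ< N τ x x<m)))
... | no x≮m = trans (at-beyond (λ i → toℕ (σ i)) x (≮⇒≥ x≮m))
  (sym (at-beyond (λ i → toℕ (τ i)) x (≮⇒≥ x≮m)))
  where
  at-beyond : ∀ {k} (f : Fin k → ℕ) x → k ≤ x → at f 0 x ≡ 0
  at-beyond {zero} f x _ = refl
  at-beyond {suc k} f (suc x) (s≤s k≤x) = at-beyond (λ i → f (Fin.suc i)) x k≤x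

des-cong : ∀ {N} {σ τ : Fun (suc N)} → (∀ i → σ i ≡ τ i) → des σ ≡ des τ
des-cong {N} {σ} {τ} σ≗τ = trans (AsSequence.des≡count N σ) (trans
  (count-cong N _ _ (λ x _ → cong₂ _<ᵇ_ (sequence-cong σ≗τ (suc x)) (sequence-cong σ≗τ x)))
  (sym (AsSequence.des≡count N τ)))

-- For σ ∈ C_{N+1}(132), the sequence v of σ is the permutation of its own
-- descent set.
module Member (N : ℕ) (σ : Fun (suc N))
  (perm : IsPerm σ) (centro : Centrosymmetric σ) (avoid : Avoids132 σ) where
  open AsSequence N σ

  v-inj : ∀ x y → x < m → y < m → v x ≡ v y → x ≡ y
  v-inj x y x<m y<m e = trans (sym (toℕ-fromℕ< x<m)) (trans (cong toℕ
    (perm _ _ (toℕ-injective (trans (sym (v-fromℕ< x x<m)) (trans e (v-fromℕ< y y<m))))))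
    (toℕ-fromℕ< y<m))

  v-avoids132 : ∀ i j k → i < j → j < k → k < m → v i < v k → v k < v j → ⊥
  v-avoids132 i j k i<j j<k k<m vi<vk vk<vj = avoid (fromℕ< i<m , fromℕ< j<m , fromℕ< k<m ,
      fin-< i<m j<m i<j , fin-< j<m k<m j<k ,
      subst₂ _<_ (v-fromℕ< i i<m) (v-fromℕ< k k<m) vi<vk ,
      subst₂ _<_ (v-fromℕ< k k<m) (v-fromℕ< j j<m) vk<vj)
    where
    j<m : j < m
    j<m = <-trans j<k k<m
    i<m : i < m
    i<m = <-trans i<j j<m
    fin-< : ∀ {x y} (x<m : x < m) (y<m : y < m) → x < y → fromℕ< x<m Fin.< fromℕ< y<m
    fin-< x<m y<m = subst₂ _<_ (sym (toℕ-fromℕ< x<m)) (sym (toℕ-fromℕ< y<m))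

  v≤N : ∀ x → x < m → v x ≤ N
  v≤N x x<m = ≤-pred (v-range x x<m)

  v-opp : ∀ x → x ≤ N → v (N ∸ x) ≡ N ∸ v x
  v-opp x x≤N = trans (sym (m+n∸m≡n (v x) _)) (cong (_∸ v x) v-centro)
    where
    i : Fin m
    i = fromℕ< (s≤s x≤N)
    v-centro : v x + v (N ∸ x) ≡ N
    v-centro = trans (cong₂ _+_ (v-fromℕ< x (s≤s x≤N))
      (trans (cong v (trans (cong (N ∸_) (sym (toℕ-fromℕ< (s≤s x≤N)))) (sym (opposite-prop i))))
             (v-toℕ (opposite i))))
      (centro i)

  -- Reversal-complementation turns a 213 into a 132.
  v-avoids213 : ∀ i j k → i < j → j < k → k < m → v j < v i → v i < v k → ⊥
  v-avoids213 i j k i<j j<k k<m vj<vi vi<vk =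
    v-avoids132 (N ∸ k) (N ∸ j) (N ∸ i) (∸-monoʳ-< j<k k≤N) (∸-monoʳ-< i<j j≤N) (s≤s (m∸n≤m N i))
      (subst₂ _<_ (sym (v-opp k k≤N)) (sym (v-opp i i≤N)) (∸-monoʳ-< vi<vk (v≤N k k<m)))
      (subst₂ _<_ (sym (v-opp i i≤N)) (sym (v-opp j j≤N)) (∸-monoʳ-< vj<vi (v≤N i i<m)))
    where
    k≤N : k ≤ N
    k≤N = ≤-pred k<m
    j≤N : j ≤ N
    j≤N = ≤-pred (<-trans j<k k<m)
    i≤N : i ≤ N
    i≤N = ≤-pred (<-trans (<-trans i<j j<k) k<m)
    i<m : i < m
    i<m = s≤s i≤N

  descent-sym : ∀ x → x < N → descent v (N ∸ suc x) ≡ descent v x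
  descent-sym x x<N = begin
    v (suc (N ∸ suc x)) <ᵇ v (N ∸ suc x) ≡⟨ cong (λ z → v z <ᵇ v (N ∸ suc x)) (+-∸-assoc 1 x<N) ⟨
    v (N ∸ x) <ᵇ v (N ∸ suc x)           ≡⟨ cong₂ _<ᵇ_ (v-opp x (<⇒≤ x<N)) (v-opp (suc x) x<N) ⟩
    N ∸ v x <ᵇ N ∸ v (suc x)
      ≡⟨ <ᵇ-cong (∸-<-reflect N _ _) (λ lt → ∸-monoʳ-< lt (v≤N x (m<n⇒m<1+n x<N))) ⟩
    v (suc x) <ᵇ v x                     ∎
    where open ≡-Reasoning

  open Runs m v v-inj v-avoids132 v-avoids213
  open DescentPerm N (descent v) hiding (m)

  <⇒≺ : ∀ q j → q < m → j < m → v q < v j → q ≺ j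
  <⇒≺ q j q<m j<m lt with <-cmp q j
  ... | tri< q<j _ _ = inj₂ (sym (<⇒same-run q j q<j j<m lt) , q<j)
  ... | tri≈ _ refl _ = ⊥-elim (n≮n (v q) lt)
  ... | tri> _ _ j<q =
    inj₁ (≤∧≢⇒< (B-mono j q (<⇒≤ j<q)) (λ e → <-asym lt (same-run⇒< j q j<q q<m (sym e))))

  ≺⇒< : ∀ q j → q < m → j < m → q ≺ j → v q < v j
  ≺⇒< q j q<m j<m (inj₂ (e , q<j)) = same-run⇒< q j q<j j<m (sym e)
  ≺⇒< q j q<m j<m (inj₁ Bj<Bq) with <-cmp q j
  ... | tri< q<j _ _ = ⊥-elim (<⇒≱ Bj<Bq (B-mono q j (<⇒≤ q<j)))
  ... | tri≈ _ refl _ = ⊥-elim (n≮n (B q) Bj<Bq)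
  ... | tri> _ _ j<q with <-cmp (v q) (v j)
  ... | tri< lt _ _ = lt
  ... | tri≈ _ e _ = ⊥-elim (<⇒≢ j<q (sym (v-inj q j q<m j<m e)))
  ... | tri> _ _ gt = ⊥-elim (<⇒≢ Bj<Bq (sym (<⇒same-run j q j<q q<m gt)))

  v≡π : ∀ j → j < m → v j ≡ π j
  v≡π j j<m = trans (SelfRank.value≡rank m v v-range v-inj j j<m) (count-cong m _ _ (λ q q<m → <ᵇ-cong
    (λ lt → ≺⇒key< q j q<m (<⇒≺ q j q<m j<m lt))
    (λ lt → ≺⇒< q j q<m j<m (key<⇒≺ q j q<m j<m lt))))

bit : ∀ {n} → Vec Bool n → ℕ → Bool
bit b = at (lookup b) false

popcount : ∀ {n} → Vec Bool n → ℕ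
popcount {n} b = count n (bit b)

-- On [2n+1], a symmetric descent set is determined by its first half.
module BitEncoding (n : ℕ) where
  N : ℕ
  N = 2 * n
  m : ℕ
  m = suc N

  N≡n+n : N ≡ n + n
  N≡n+n = cong (n +_) (+-identityʳ n)

  mirror : Vec Bool n → ℕ → Bool
  mirror b x = if x <ᵇ n then bit b x else bit b (N ∸ suc x)

  mirror-lo : ∀ b x → x < n → mirror b x ≡ bit b x
  mirror-lo b x x<n rewrite <ᵇ-true x<n = refl

  mirror-hi : ∀ b x → n ≤ x → mirror b x ≡ bit b (N ∸ suc x)
  mirror-hi b x n≤x rewrite <ᵇ-false (≤⇒≯ n≤x) = refl

  reflect-hi : ∀ x → n ≤ x → x < N → N ∸ suc x < n
  reflect-hi x n≤x x<N = begin-strict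
    N ∸ suc x       ≤⟨ ∸-monoʳ-≤ N (s≤s n≤x) ⟩
    N ∸ suc n       ≡⟨ cong (_∸ suc n) N≡n+n ⟩
    (n + n) ∸ suc n <⟨ ∸-monoʳ-< (n<1+n n) (subst (suc n ≤_) N≡n+n (≤-trans (s≤s n≤x) x<N)) ⟩
    (n + n) ∸ n     ≡⟨ m+n∸n≡m n n ⟩
    n               ∎
    where open ≤-Reasoning

  reflect-lo : ∀ x → x < n → n ≤ N ∸ suc x
  reflect-lo x x<n = begin
    n                ≤⟨ m≤m+n n (n ∸ suc x) ⟩
    n + (n ∸ suc x)  ≡⟨ +-∸-assoc n x<n ⟨
    (n + n) ∸ suc x  ≡⟨ cong (_∸ suc x) N≡n+n ⟨
    N ∸ suc x        ∎
    where open ≤-Reasoning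

  reflect-involutive : ∀ x → x < N → N ∸ suc (N ∸ suc x) ≡ x
  reflect-involutive x x<N = trans (cong (N ∸_) (sym (+-∸-assoc 1 x<N))) (m∸[m∸n]≡n (<⇒≤ x<N))

  mirror-sym : ∀ b x → x < N → mirror b (N ∸ suc x) ≡ mirror b x
  mirror-sym b x x<N with <-cmp x n
  ... | tri< x<n _ _ = trans (mirror-hi b _ (reflect-lo x x<n))
    (trans (cong (bit b) (reflect-involutive x x<N)) (sym (mirror-lo b x x<n)))
  ... | tri≈ _ x≡n _ = trans (mirror-lo b _ (reflect-hi x (≤-reflexive (sym x≡n)) x<N))
    (sym (mirror-hi b x (≤-reflexive (sym x≡n))))
  ... | tri> _ _ n<x = trans (mirror-lo b _ (reflect-hi x (<⇒≤ n<x) x<N))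
    (sym (mirror-hi b x (<⇒≤ n<x)))

  -- Each set bit contributes two descents.
  count-mirror : ∀ b → count N (mirror b) ≡ 2 * popcount b
  count-mirror b = begin
    count N (mirror b)                                  ≡⟨ count-+ n (n + 0) (mirror b) ⟩
    count n (mirror b) + count (n + 0) second
      ≡⟨ cong₂ _+_ (count-cong n _ _ (mirror-lo b)) (cong (λ z → count z second) (+-identityʳ n)) ⟩
    popcount b + count n second                         ≡⟨ cong (popcount b +_) (count-cong n _ _ second-half) ⟩
    popcount b + count n (λ i → bit b (n ∸ suc i))      ≡⟨ cong (popcount b +_) (count-reverse n (bit b)) ⟨
    popcount b + popcount b                             ≡⟨ cong (popcount b +_) (+-identityʳ (popcount b)) ⟨
    2 * popcount b                                      ∎
    where
    open ≡-Reasoning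
    second : ℕ → Bool
    second i = mirror b (n + i)
    second-half : ∀ i → i < n → second i ≡ bit b (n ∸ suc i)
    second-half i _ = trans (mirror-hi b (n + i) (m≤m+n n i))
      (cong (bit b) (trans (cong₂ _∸_ N≡n+n (sym (+-suc n i))) ([m+n]∸[m+o]≡n∸o n n (suc i))))

  module Decode (b : Vec Bool n) where
    open DescentPerm N (mirror b) public hiding (m)

    decode : Fun m
    decode i = fromℕ< (rank<m (toℕ i) (toℕ<n i))

    open AsSequence N decode using (v; v-fromℕ<)

    v≡π : ∀ x → x < m → v x ≡ π x
    v≡π x x<m = trans (v-fromℕ< x x<m) (trans (toℕ-fromℕ< _) (cong π (toℕ-fromℕ< x<m)))

    decode-perm : IsPerm decode
    decode-perm i j e = toℕ-injective (rank-inj (toℕ i) (toℕ j) (toℕ<n i) (toℕ<n j)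
      (trans (sym (toℕ-fromℕ< _)) (trans (cong toℕ e) (toℕ-fromℕ< _))))

    decode-centro : Centrosymmetric decode
    decode-centro i =
      trans (cong₂ _+_ (toℕ-fromℕ< _) (trans (toℕ-fromℕ< _) (cong π (opposite-prop i))))
      (Symmetric.π-centrosymmetric N (mirror b) (mirror-sym b) (toℕ i) (≤-pred (toℕ<n i)))

    decode-avoids : Avoids132 decode
    decode-avoids (i , j , k , i<j , j<k , lt₁ , lt₂) =
      π-avoids132 (toℕ i) (toℕ j) (toℕ k) i<j j<k (toℕ<n k)
        (subst₂ _<_ (toℕ-fromℕ< _) (toℕ-fromℕ< _) lt₁)
        (subst₂ _<_ (toℕ-fromℕ< _) (toℕ-fromℕ< _) lt₂)

    decode-descent : ∀ x → x < N → descent v x ≡ mirror b x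
    decode-descent x x<N = trans (cong₂ _<ᵇ_ (v≡π (suc x) (s≤s x<N)) (v≡π x (m<n⇒m<1+n x<N)))
      (π-descent x (s≤s x<N))

    decode-des : des decode ≡ 2 * popcount b
    decode-des = trans (AsSequence.des≡count N decode)
      (trans (count-cong N _ _ decode-descent) (count-mirror b))

  open Decode public using (decode)

  encode : Fun m → Vec Bool n
  encode σ = Vec.tabulate (λ i → descent (AsSequence.v N σ) (toℕ i))

  encode-decode : ∀ b → encode (decode b) ≡ b
  encode-decode b = trans (Vecᵖ.tabulate-cong (λ i →
      trans (Decode.decode-descent b (toℕ i) (<-≤-trans (toℕ<n i) (m≤m+n n (n + 0))))
            (trans (mirror-lo b (toℕ i) (toℕ<n i)) (at-toℕ (lookup b) false i))))
    (Vecᵖ.tabulate∘lookup b)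

  encode-cong : ∀ σ τ → (∀ i → σ i ≡ τ i) → encode σ ≡ encode τ
  encode-cong σ τ σ≗τ = Vecᵖ.tabulate-cong (λ i →
    cong₂ _<ᵇ_ (sequence-cong σ≗τ (suc (toℕ i))) (sequence-cong σ≗τ (toℕ i)))

  decode-encode : ∀ σ → IsPerm σ → Centrosymmetric σ → Avoids132 σ →
    ∀ i → σ i ≡ decode (encode σ) i
  decode-encode σ perm centro avoid i = toℕ-injective (begin
      toℕ (σ i)                            ≡⟨ AsSequence.v-toℕ N σ i ⟨
      v (toℕ i)                            ≡⟨ M.v≡π (toℕ i) (toℕ<n i) ⟩
      DescentPerm.π N (descent v) (toℕ i)
        ≡⟨ π-cong N (descent v) (mirror (encode σ)) agree (toℕ i) (toℕ<n i) ⟩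
      DescentPerm.π N (mirror (encode σ)) (toℕ i) ≡⟨ toℕ-fromℕ< _ ⟨
      toℕ (decode (encode σ) i)            ∎)
    where
    open ≡-Reasoning
    open AsSequence N σ using (v)
    module M = Member N σ perm centro avoid
    bit-encode : ∀ x → x < n → bit (encode σ) x ≡ descent v x
    bit-encode x x<n = trans (at-fromℕ< _ false x x<n)
      (trans (Vecᵖ.lookup∘tabulate _ (fromℕ< x<n)) (cong (descent v) (toℕ-fromℕ< x<n)))
    agree : ∀ x → x < N → descent v x ≡ mirror (encode σ) x
    agree x x<N with x <? n
    ... | yes x<n = sym (trans (mirror-lo (encode σ) x x<n) (bit-encode x x<n))
    ... | no x≮n = sym (trans (mirror-hi (encode σ) x (≮⇒≥ x≮n))
      (trans (bit-encode _ (reflect-hi x (≮⇒≥ x≮n) x<N)) (M.descent-sym x x<N)))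

bitCount : ℕ → ℕ → ℕ
bitCount n k = sumOver (allBits n) (λ b → 𝟙 (2 * popcount b ≟ k))

member-resp : ∀ n k (σ τ : Fun (suc (2 * n))) → σ ≗ᶠ τ → InC132des n k τ → InC132des n k σ
member-resp n k σ τ σ≗τ (perm , centro , avoid , desτ) =
  perm′ , centro′ , avoid′ , trans (des-cong σ≗τ) desτ
  where
  perm′ : IsPerm σ
  perm′ i j e = perm i j (trans (sym (σ≗τ i)) (trans e (σ≗τ j)))
  centro′ : Centrosymmetric σ
  centro′ i = trans (cong₂ _+_ (cong toℕ (σ≗τ i)) (cong toℕ (σ≗τ (opposite i)))) (centro i)
  avoid′ : Avoids132 σ
  avoid′ (i , j , l , i<j , j<l , lt₁ , lt₂) = avoid (i , j , l , i<j , j<l ,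
    subst₂ (λ u w → toℕ u < toℕ w) (σ≗τ i) (σ≗τ l) lt₁ ,
    subst₂ (λ u w → toℕ u < toℕ w) (σ≗τ l) (σ≗τ j) lt₂)

r≡bitCount : ∀ n k → r n k ≡ bitCount n k
r≡bitCount n k = trans
  (count-bijection (allFuns m m) (allBits n) _≗ᶠ_ _≗ᶠ?_ _≟ᵇᵛ_
    (inC132des? n k) (λ b → 2 * popcount b ≟ k)
    encode decode (allFuns-once m m) (allBits-once n)
    (member-resp n k) encode-cong encode-decode
    (λ b 2pop≡k → Decode.decode-perm b , Decode.decode-centro b , Decode.decode-avoids b ,
                  trans (Decode.decode-des b) 2pop≡k)
    (λ σ (perm , centro , avoid , desσ) → let σ≗ = decode-encode σ perm centro avoid in
       σ≗ , trans (sym (Decode.decode-des (encode σ))) (trans (sym (des-cong σ≗)) desσ)))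
  (length-filter _ (allBits n))
  where open BitEncoding n

-- Splitting by the first bit: a set first bit adds two descents.
bitCount-suc : ∀ n k →
  bitCount (suc n) k ≡ bitCount n k + sumOver (allBits n) (λ b → 𝟙 (suc (suc (2 * popcount b)) ≟ k))
bitCount-suc n k = trans (sumOver-++ (map (false Vec.∷_) (allBits n)) _ _)
  (cong₂ _+_ (sumOver-map _ (allBits n) _) (trans (sumOver-map _ (allBits n) _)
    (sumOver-cong (allBits n) _ _ (λ b → cong (λ z → 𝟙 (z ≟ k)) (*-suc 2 (popcount b))))))

bitCount-suc-0 : ∀ n → bitCount (suc n) 0 ≡ bitCount n 0
bitCount-suc-0 n = trans (bitCount-suc n 0) (trans (cong (bitCount n 0 +_)
  (trans (sumOver-cong (allBits n) _ _ (λ b → 𝟙-no (suc (suc (2 * popcount b)) ≟ 0) (λ ())))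
    (sumOver-0 (allBits n))))
  (+-identityʳ _))

bitCount-suc-1 : ∀ n → bitCount (suc n) 1 ≡ bitCount n 1
bitCount-suc-1 n = trans (bitCount-suc n 1) (trans (cong (bitCount n 1 +_)
  (trans (sumOver-cong (allBits n) _ _ (λ b → 𝟙-no (suc (suc (2 * popcount b)) ≟ 1) (λ ())))
    (sumOver-0 (allBits n))))
  (+-identityʳ _))

bitCount-suc-2 : ∀ n k → bitCount (suc n) (suc (suc k)) ≡ bitCount n (suc (suc k)) + bitCount n k
bitCount-suc-2 n k = trans (bitCount-suc n (suc (suc k))) (cong (bitCount n (suc (suc k)) +_)
  (sumOver-cong (allBits n) _ _ (λ b → 𝟙-cong (_ ≟ suc (suc k)) (2 * popcount b ≟ k)
    (λ e → suc-injective (suc-injective e)) (cong (λ z → suc (suc z))))))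

bitCount-odd : ∀ n j → bitCount n (suc (2 * j)) ≡ 0
bitCount-odd zero j = refl
bitCount-odd (suc n) zero = trans (bitCount-suc-1 n) (bitCount-odd n 0)
bitCount-odd (suc n) (suc j) rewrite *-suc 2 j =
  trans (bitCount-suc-2 n (suc (2 * j))) (cong₂ _+_
    (subst (λ z → bitCount n (suc z) ≡ 0) (*-suc 2 j) (bitCount-odd n (suc j))) (bitCount-odd n j))

bitCount-even : ∀ n j → bitCount n (2 * j) ≡ n C j
bitCount-even zero zero = refl
bitCount-even zero (suc j) = refl
bitCount-even (suc n) zero = trans (bitCount-suc-0 n) (bitCount-even n 0)
bitCount-even (suc n) (suc j) rewrite *-suc 2 j = begin
  bitCount (suc n) (suc (suc (2 * j)))         ≡⟨ bitCount-suc-2 n (2 * j) ⟩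
  bitCount n (suc (suc (2 * j))) + bitCount n (2 * j)
    ≡⟨ cong₂ _+_ (subst (λ z → bitCount n z ≡ n C suc j) (*-suc 2 j) (bitCount-even n (suc j)))
                 (bitCount-even n j) ⟩
  n C suc j + n C j                            ≡⟨ +-comm (n C suc j) (n C j) ⟩
  n C j + n C suc j                            ≡⟨ nCk+nC[k+1]≡[n+1]C[k+1] n j ⟩
  suc n C suc j                                ∎
  where open ≡-Reasoning

module SeriesIdentity where
  open import Data.Integer using (ℤ; +_; -_) renaming (_+_ to _+ℤ_; _*_ to _*ℤ_)
  open import Data.Integer.Properties as ℤᵖ using ()
  open import Data.Integer.Solver using (module +-*-Solver)
  open import Data.List using (applyUpTo; foldr)

  Σ< : ℕ → (ℕ → ℤ) → ℤ
  Σ< L f = foldr _+ℤ_ (+ 0) (applyUpTo f L)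

  map-applyUpTo : ∀ {A B : Set} (f : A → B) (g : ℕ → A) L →
    map f (applyUpTo g L) ≡ applyUpTo (λ i → f (g i)) L
  map-applyUpTo f g zero = refl
  map-applyUpTo f g (suc L) = cong (f (g 0) ∷_) (map-applyUpTo f (λ i → g (suc i)) L)

  sumTo≡Σ< : ∀ n f → sumTo n f ≡ Σ< (suc n) f
  sumTo≡Σ< n f = cong (foldr _+ℤ_ (+ 0)) (map-applyUpTo f (λ i → i) (suc n))

  Σ<-snoc : ∀ L f → Σ< (suc L) f ≡ Σ< L f +ℤ f L
  Σ<-snoc zero f = trans (ℤᵖ.+-identityʳ (f 0)) (sym (ℤᵖ.+-identityˡ (f 0)))
  Σ<-snoc (suc L) f = trans (cong (f 0 +ℤ_) (Σ<-snoc L (λ i → f (suc i))))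
    (sym (ℤᵖ.+-assoc (f 0) _ _))

  Σ<-zero : ∀ L f → (∀ i → i < L → f i ≡ + 0) → Σ< L f ≡ + 0
  Σ<-zero zero f _ = refl
  Σ<-zero (suc L) f f≡0 = cong₂ _+ℤ_ (f≡0 0 z<s)
    (Σ<-zero L (λ i → f (suc i)) (λ i i<L → f≡0 (suc i) (s<s i<L)))

  *-1 : ∀ i → i *ℤ - (+ 1) ≡ - i
  *-1 i = trans (ℤᵖ.*-comm i _) (ℤᵖ.-1*i≡-i i)

  ∸-positive : ∀ k i → i < k → Σ ℕ (λ c → k ∸ i ≡ suc c)
  ∸-positive (suc k) i (s≤s i≤k) = k ∸ i , +-∸-assoc 1 i≤k

  inner : Series2 → ℕ → ℕ → ℕ → ℤ
  inner F a c k = Σ< (suc k) (λ b → F a b *ℤ denomSer c (k ∸ b))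

  inner-row0 : ∀ F a k → inner F a 0 k ≡ F a k
  inner-row0 F a k = begin
    Σ< (suc k) h         ≡⟨ Σ<-snoc k h ⟩
    Σ< k h +ℤ h k        ≡⟨ cong₂ _+ℤ_ (Σ<-zero k h below-k) (cong (λ x → F a k *ℤ denomSer 0 x) (n∸n≡0 k)) ⟩
    + 0 +ℤ F a k *ℤ + 1  ≡⟨ ℤᵖ.+-identityˡ _ ⟩
    F a k *ℤ + 1         ≡⟨ ℤᵖ.*-identityʳ (F a k) ⟩
    F a k                ∎
    where
    open ≡-Reasoning
    h : ℕ → ℤ
    h b = F a b *ℤ denomSer 0 (k ∸ b)
    below-k : ∀ i → i < k → h i ≡ + 0
    below-k i i<k with c , e ← ∸-positive k i i<k =
      trans (cong (λ x → F a i *ℤ denomSer 0 x) e) (ℤᵖ.*-zeroʳ (F a i))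

  inner-row1-0 : ∀ F a → inner F a 1 0 ≡ - F a 0
  inner-row1-0 F a = trans (ℤᵖ.+-identityʳ (F a 0 *ℤ - (+ 1))) (*-1 (F a 0))

  inner-row1-1 : ∀ F a → inner F a 1 1 ≡ - F a 1
  inner-row1-1 F a = trans (cong₂ _+ℤ_ (ℤᵖ.*-zeroʳ (F a 0)) (ℤᵖ.+-identityʳ (F a 1 *ℤ - (+ 1))))
    (trans (ℤᵖ.+-identityˡ _) (*-1 (F a 1)))

  inner-row1-2 : ∀ F a k → inner F a 1 (suc (suc k)) ≡ - F a k +ℤ - F a (suc (suc k))
  inner-row1-2 F a k = begin
    Σ< (suc K) h                                ≡⟨ Σ<-snoc K h ⟩
    Σ< K h +ℤ h K                               ≡⟨ cong (_+ℤ h K) (Σ<-snoc (suc k) h) ⟩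
    (Σ< (suc k) h +ℤ h (suc k)) +ℤ h K          ≡⟨ cong (λ x → (x +ℤ h (suc k)) +ℤ h K) (Σ<-snoc k h) ⟩
    ((Σ< k h +ℤ h k) +ℤ h (suc k)) +ℤ h K
      ≡⟨ cong₂ _+ℤ_ (cong₂ _+ℤ_ (cong₂ _+ℤ_ (Σ<-zero k h below-k) at-k) at-k+1) at-K ⟩
    ((+ 0 +ℤ - F a k) +ℤ + 0) +ℤ - F a K        ≡⟨ cong (_+ℤ - F a K) (ℤᵖ.+-identityʳ (+ 0 +ℤ - F a k)) ⟩
    (+ 0 +ℤ - F a k) +ℤ - F a K                 ≡⟨ cong (_+ℤ - F a K) (ℤᵖ.+-identityˡ (- F a k)) ⟩
    - F a k +ℤ - F a K                          ∎
    where
    open ≡-Reasoning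
    K : ℕ
    K = suc (suc k)
    h : ℕ → ℤ
    h b = F a b *ℤ denomSer 1 (K ∸ b)
    at-K : h K ≡ - F a K
    at-K = trans (cong (λ x → F a K *ℤ denomSer 1 x) (n∸n≡0 K)) (*-1 (F a K))
    at-k+1 : h (suc k) ≡ + 0
    at-k+1 = trans (cong (λ x → F a (suc k) *ℤ denomSer 1 x) (m+n∸n≡m 1 k)) (ℤᵖ.*-zeroʳ (F a (suc k)))
    at-k : h k ≡ - F a k
    at-k = trans (cong (λ x → F a k *ℤ denomSer 1 x) (m+n∸n≡m 2 k)) (*-1 (F a k))
    below-k : ∀ i → i < k → h i ≡ + 0
    below-k i i<k with c , e ← ∸-positive k i i<k =
      trans (cong (λ x → F a i *ℤ denomSer 1 x)
                  (trans (+-∸-assoc 2 (<⇒≤ i<k)) (cong (λ z → suc (suc z)) e)))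
        (ℤᵖ.*-zeroʳ (F a i))

  inner-row2+ : ∀ F a c k → inner F a (suc (suc c)) k ≡ + 0
  inner-row2+ F a c k = Σ<-zero (suc k) _ (λ i _ → ℤᵖ.*-zeroʳ (F a i))

  -- Hence row n+1 of the product only sees the rows n and n+1 of F.
  conv-0 : ∀ F k → (F ⋆ denomSer) 0 k ≡ F 0 k
  conv-0 F k = trans (sumTo≡Σ< 0 (λ a → sumTo k (λ b → F a b *ℤ denomSer (0 ∸ a) (k ∸ b))))
    (trans (ℤᵖ.+-identityʳ _)
      (trans (sumTo≡Σ< k (λ b → F 0 b *ℤ denomSer 0 (k ∸ b))) (inner-row0 F 0 k)))

  conv-suc : ∀ F n k → (F ⋆ denomSer) (suc n) k ≡ inner F n 1 k +ℤ F (suc n) k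
  conv-suc F n k = begin
    (F ⋆ denomSer) (suc n) k              ≡⟨ sumTo≡Σ< (suc n) g ⟩
    Σ< (suc (suc n)) g                    ≡⟨ Σ<-snoc (suc n) g ⟩
    Σ< (suc n) g +ℤ g (suc n)             ≡⟨ cong (_+ℤ g (suc n)) (Σ<-snoc n g) ⟩
    (Σ< n g +ℤ g n) +ℤ g (suc n)          ≡⟨ cong₂ _+ℤ_ (cong₂ _+ℤ_ (Σ<-zero n g below-n) at-n) at-n+1 ⟩
    (+ 0 +ℤ inner F n 1 k) +ℤ F (suc n) k ≡⟨ cong (_+ℤ F (suc n) k) (ℤᵖ.+-identityˡ (inner F n 1 k)) ⟩
    inner F n 1 k +ℤ F (suc n) k          ∎
    where
    open ≡-Reasoning
    g : ℕ → ℤ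
    g a = sumTo k (λ b → F a b *ℤ denomSer (suc n ∸ a) (k ∸ b))
    g≡inner : ∀ a → g a ≡ inner F a (suc n ∸ a) k
    g≡inner a = sumTo≡Σ< k (λ b → F a b *ℤ denomSer (suc n ∸ a) (k ∸ b))
    at-n : g n ≡ inner F n 1 k
    at-n = trans (g≡inner n) (cong (λ c → inner F n c k) (m+n∸n≡m 1 n))
    at-n+1 : g (suc n) ≡ F (suc n) k
    at-n+1 = trans (g≡inner (suc n))
      (trans (cong (λ c → inner F (suc n) c k) (n∸n≡0 n)) (inner-row0 F (suc n) k))
    below-n : ∀ i → i < n → g i ≡ + 0
    below-n i i<n with c , e ← ∸-positive n i i<n =
      trans (g≡inner i) (trans (cong (λ c → inner F i c k) (trans (+-∸-assoc 1 (<⇒≤ i<n)) (cong suc e)))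
        (inner-row2+ F i c k))

  cancel : ∀ a b → (- b +ℤ - a) +ℤ (a +ℤ b) ≡ + 0
  cancel = solve 2 (λ a b → (:- b :+ :- a) :+ (a :+ b) := con (+ 0)) refl
    where open +-*-Solver

  identity : (G : ℕ → ℕ → ℕ) →
    G 0 0 ≡ 1 → (∀ k → G 0 (suc k) ≡ 0) →
    (∀ n → G (suc n) 0 ≡ G n 0) → (∀ n → G (suc n) 1 ≡ G n 1) →
    (∀ n k → G (suc n) (suc (suc k)) ≡ G n (suc (suc k)) + G n k) →
    ∀ n k → ((λ a b → + G a b) ⋆ denomSer) n k ≡ oneSer n k
  identity G G00 G0k rec0 rec1 rec = coefficient
    where
    F : Series2
    F a b = + G a b
    coefficient : ∀ n k → (F ⋆ denomSer) n k ≡ oneSer n k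
    coefficient zero zero = trans (conv-0 F 0) (cong +_ G00)
    coefficient zero (suc k) = trans (conv-0 F (suc k)) (cong +_ (G0k k))
    coefficient (suc n) zero = trans (conv-suc F n 0)
      (trans (cong₂ _+ℤ_ (inner-row1-0 F n) (cong +_ (rec0 n))) (ℤᵖ.+-inverseˡ (F n 0)))
    coefficient (suc n) (suc zero) = trans (conv-suc F n 1)
      (trans (cong₂ _+ℤ_ (inner-row1-1 F n) (cong +_ (rec1 n))) (ℤᵖ.+-inverseˡ (F n 1)))
    coefficient (suc n) (suc (suc k)) = trans (conv-suc F n (suc (suc k)))
      (trans (cong₂ _+ℤ_ (inner-row1-2 F n k)
                         (trans (cong +_ (rec n k)) (ℤᵖ.pos-+ (G n (suc (suc k))) (G n k))))
        (cancel (F n (suc (suc k))) (F n k)))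

-- R(x,y)·(1 - x - xy²) = 1 coefficientwise, and r n k = C(n, k/2) for even k,
-- r n k = 0 for odd k.  Both follow from
-- r = bitCount: the Pascal recurrence of bitCount feeds the series identity.
theorem2 : ((n k : ℕ) → (Rser ⋆ denomSer) n k ≡ oneSer n k)
    × ((n j : ℕ) → 1 ≤ n → (r n (2 * j) ≡ n C j) × (r n (suc (2 * j)) ≡ 0))
theorem2 = series , λ n j _ → trans (r≡bitCount n (2 * j)) (bitCount-even n j) ,
                              trans (r≡bitCount n (suc (2 * j))) (bitCount-odd n j)
  where
  via-bitCount : ∀ n k n′ k′ → bitCount n k ≡ bitCount n′ k′ → r n k ≡ r n′ k′
  via-bitCount n k n′ k′ e = trans (r≡bitCount n k) (trans e (sym (r≡bitCount n′ k′)))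

  series : (n k : ℕ) → (Rser ⋆ denomSer) n k ≡ oneSer n k
  series = SeriesIdentity.identity r (r≡bitCount 0 0) (λ k → r≡bitCount 0 (suc k))
    (λ n → via-bitCount (suc n) 0 n 0 (bitCount-suc-0 n))
    (λ n → via-bitCount (suc n) 1 n 1 (bitCount-suc-1 n))
    (λ n k → trans (r≡bitCount (suc n) (suc (suc k))) (trans (bitCount-suc-2 n k)
      (sym (cong₂ _+_ (r≡bitCount n (suc (suc k))) (r≡bitCount n k)))))
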